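{- Let $D$ be a finite set with $|D|\ge2$. Every conservative weakly log-modular weighted constraint language over $D$ is balanced.
   Context: A weighted constraint language is a set $\mathcal{F}$ of functions $D^k\to\mathbb{Q}_{\ge0}$ (various $k$); it is conservative if it contains every unary function $D\to\mathbb{Q}_{\ge0}$. $\mathrm{EQ}(x,y)=1$ if $x=y$, else $0$. A pps-formula over $\mathcal{F}$ is $\sum_{v_{n+1},\dots,v_{n+k}}\prod_j\phi_j$ where each $\phi_j$ applies a function of $\mathcal{F}$ to a tuple of variables from $v_1,\dots,v_{n+k}$ (repetitions allowed); it represents the function of $v_1,\dots,v_n$ obtained by summing the product over all assignments in $D^k$ to $v_{n+1},\dots,v_{n+k}$. The functional clone $\langle\mathcal{F}\rangle_\#$ is the set of functions represented by pps-formulas over $\mathcal{F}\cup\{\mathrm{EQ}\}$. $\mathcal{F}$ is weakly log-modular if for every binary $F\in\langle\mathcal{F}\rangle_\#$ and all $a,b\in D$: $F(a,a)F(b,b)=F(a,b)F(b,a)$, or $F(a,a)=F(b,b)=0$, or $F(a,b)=F(b,a)=0$. For a matrix $\mathbf{M}$, let $G_{\mathbf{M}}$ be the bipartite graph on rows and columns with an edge $(r,c)$ iff $\mathbf{M}_{rc}\ne0$; a block is the submatrix on the rows and columns of a connected component of $G_{\mathbf{M}}$; $\mathbf{M}$ has block-rank $1$ if all its blocks have rank $1$. $\mathcal{F}$ is balanced if for every $F\in\langle\mathcal{F}\rangle_\#$ of arity $n\ge2$ and every $0<k<n$, the $|D|^k\times|D|^{n-k}$ matrix with entries $F((x_1,\dots,x_k),(x_{k+1},\dots,x_n))$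 has block-rank $1$. -}

module Defs where

open import Level using (Level; suc; _⊔_) renaming (zero to lzero)
open import Data.Nat using (ℕ; zero; suc; _+_)
open import Data.Fin using (Fin)
open import Data.Vec using (Vec; []; _∷_; lookup; map)
open import Data.List using (List; []; _∷_; [_]; concatMap; allFin; foldr)
import Data.List as List
open import Data.Product using (Σ; ∃; _×_; _,_)
open import Data.Sum using (_⊎_; inj₁; inj₂)
open import Data.Rational using (ℚ; 0ℚ; 1ℚ; _*_; _≤_) renaming (_+_ to _+ℚ_)
open import Relation.Binary.PropositionalEquality using (_≡_)
open import Relation.Nullary using (¬_)
open import Relation.Binary.Construct.Closure.ReflexiveTransitive using (Star)
open import Data.Fin using (_≟_)
open import Relation.Nullary.Decidable using (does)
open import Data.Bool using (if_then_else_)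

-- The domain is D = Fin d.  A weighted function of arity k is a map
-- Vec (Fin d) k → ℚ (nonnegativity is imposed where needed).
Fun : ℕ → ℕ → Set
Fun d k = Vec (Fin d) k → ℚ

Lang : ℕ → Set₁
Lang d = (k : ℕ) → Fun d k → Set

NonNeg : ∀ {d} → Lang d → Set
NonNeg {d} L = ∀ k (F : Fun d k) → L k F → ∀ x → 0ℚ ≤ F x

Conservative : ∀ {d} → Lang d → Set
Conservative {d} L =
  (u : Fin d → ℚ) → (∀ x → 0ℚ ≤ u x) →
  Σ (Fun d 1) λ G → L 1 G × (∀ x → G (x ∷ []) ≡ u x)

EQ : ∀ {d} → Fin d → Fin d → ℚ
EQ x y = if does (x ≟ y) then 1ℚ else 0ℚ

data Atom {d : ℕ} (L : Lang d) (m : ℕ) : Set where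
  lang : ∀ {a} (G : Fun d a) → L a G → Vec (Fin m) a → Atom L m
  eq   : Fin m → Fin m → Atom L m

evalAtom : ∀ {d} {L : Lang d} {m} → Atom L m → Vec (Fin d) m → ℚ
evalAtom (lang G _ vs) env = G (map (λ i → lookup env i) vs)
evalAtom (eq i j) env = EQ (lookup env i) (lookup env j)

allVecs : ∀ d k → List (Vec (Fin d) k)
allVecs d zero = [ [] ]
allVecs d (suc k) = concatMap (λ x → List.map (x ∷_) (allVecs d k)) (allFin d)

sumℚ : List ℚ → ℚ
sumℚ = foldr _+ℚ_ 0ℚ

record PPS {d : ℕ} (L : Lang d) (n : ℕ) : Set where
  constructor pps
  field
    k     : ℕ
    atoms : List (Atom L (n + k))

⟦_⟧ : ∀ {d} {L : Lang d} {n} → PPS L n → Fun d n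
⟦_⟧ {d} (pps k atoms) x =
  sumℚ (List.map (λ y → foldr (λ a acc → evalAtom a (x Data.Vec.++ y) * acc) 1ℚ atoms)
                 (allVecs d k))

InClone : ∀ {d} → Lang d → (n : ℕ) → Fun d n → Set
InClone L n F = Σ (PPS L n) λ φ → ∀ x → F x ≡ ⟦ φ ⟧ x

WeaklyLogModular : ∀ {d} → Lang d → Set
WeaklyLogModular {d} L =
  (F : Fun d 2) → InClone L 2 F → (a b : Fin d) →
    (F (a ∷ a ∷ []) * F (b ∷ b ∷ []) ≡ F (a ∷ b ∷ []) * F (b ∷ a ∷ []))
  ⊎ ((F (a ∷ a ∷ []) ≡ 0ℚ × F (b ∷ b ∷ []) ≡ 0ℚ)
  ⊎ (F (a ∷ b ∷ []) ≡ 0ℚ × F (b ∷ a ∷ []) ≡ 0ℚ))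

module _ {R C : Set} (M : R → C → ℚ) where
  data Edge : R ⊎ C → R ⊎ C → Set where
    rc : ∀ r c → ¬ (M r c ≡ 0ℚ) → Edge (inj₁ r) (inj₂ c)
    cr : ∀ r c → ¬ (M r c ≡ 0ℚ) → Edge (inj₂ c) (inj₁ r)

  Conn : R ⊎ C → R ⊎ C → Set
  Conn = Star Edge

  -- Block-rank 1: for each block (connected component containing a nonzero
  -- entry M r₀ c₀), the submatrix on its rows and columns has rank 1, i.e.
  -- is an outer product u vᵀ (it is nonzero since it contains M r₀ c₀).
  BlockRank1 : Set
  BlockRank1 = ∀ r₀ c₀ → ¬ (M r₀ c₀ ≡ 0ℚ) →
    Σ (R → ℚ) λ u → Σ (C → ℚ) λ v →
      ∀ r c → Conn (inj₁ r₀) (inj₁ r) → Conn (inj₁ r₀) (inj₂ c) →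
        M r c ≡ u r * v c

-- Balanced: every F ∈ ⟨L⟩# of arity n = k + m with 0 < k < n (i.e. k, m ≥ 1)
-- gives a |D|^k × |D|^m matrix of block-rank 1.
Balanced : ∀ {d} → Lang d → Set
Balanced {d} L =
  (k m : ℕ) → 1 Data.Nat.≤ k → 1 Data.Nat.≤ m →
  (F : Fun d (k + m)) → InClone L (k + m) F →
  BlockRank1 (λ (r : Vec (Fin d) k) (c : Vec (Fin d) m) → F (r Data.Vec.++ c))

module Submission where

-- Fix F in the clone ⟨L⟩# of arity k + m and read it as the matrix M r c = F (r ++ c).
-- Call two rows a, b "proportional or disjoint" (PD) when a z b z' = a z' b z for all
-- z, z' or a z b z = 0 for all z.  Block-rank 1 follows once any two rows of M are PD:
-- walking along G_M from a nonzero entry M r₀ c₀, every row met is proportional to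
-- row r₀, so M r c = M r c₀ · M r₀ c / M r₀ c₀ on the whole block.
--
-- Rows are shown PD by induction on the row length k.  For rows x, x' of length one,
-- G(u,w) = Σ_z F(u,z) F(w,z) is a binary function of the clone, and weak
-- log-modularity of G at (x,x') gives PD through the equality case of Cauchy–Schwarz
-- (all values are nonnegative).  For rows x∷s and x'∷s' three PD facts are combined
-- by an algebraic lemma on four functions: first coordinates x, x' (the base case);
-- tails s, s' with the first coordinate moved into the columns (induction); tails
-- s, s' of F(x,·) + F(x',·) = Σ_y (EQ x y + EQ x' y) F(y,·), a clone function because
-- L is conservative (induction).

open import Defs
open import Data.Nat using (ℕ; zero; suc; _+_; _≤_)
open import Data.Fin as Fin using (Fin; zero; suc; _↑ˡ_; _↑ʳ_; splitAt)
open import Data.Vec as Vec using (Vec; []; _∷_; lookup; tabulate; _++_)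
open import Data.Vec.Properties
  using (lookup-++ˡ; lookup-++ʳ; lookup-splitAt; tabulate∘lookup; tabulate-cong; lookup∘tabulate; map-∘; map-cong)
open import Data.List as List using (List; []; _∷_; concatMap; allFin; foldr)
open import Data.List.Properties using (map-tabulate)
open import Data.List.Membership.Propositional using (_∈_)
open import Data.List.Membership.Propositional.Properties using (∈-allFin; ∈-concatMap⁺; ∈-map⁺)
open import Data.List.Relation.Unary.Any as Any using (here; there)
open import Data.Product using (_×_; _,_)
open import Data.Sum using (_⊎_; inj₁; inj₂; [_,_]′)
open import Data.Rational using (ℚ; 0ℚ; 1ℚ; _*_; _-_; -_; 1/_; ≢-nonZero; nonNegative; nonPositive)
  renaming (_+_ to _+ℚ_; _≤_ to _≤ℚ_)
import Data.Rational.Properties as ℚP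
open import Algebra.Bundles using (CommutativeMonoid)
import Algebra.Properties.CommutativeSemigroup as CommSemigroupProperties
open import Data.Rational.Solver using (module +-*-Solver)
open import Data.Empty using (⊥-elim)
open import Relation.Nullary using (¬_; yes; no)
open import Relation.Binary.PropositionalEquality
open import Relation.Binary.Construct.Closure.ReflexiveTransitive using (Star; ε; _◅_)
open import Function using (_∘_; id)

open CommSemigroupProperties (CommutativeMonoid.commutativeSemigroup ℚP.+-0-commutativeMonoid)
  using () renaming (interchange to +-interchange)
open CommSemigroupProperties (CommutativeMonoid.commutativeSemigroup ℚP.*-1-commutativeMonoid)
  using () renaming (x∙yz≈y∙xz to *-left-swap)
open import Algebra.Properties.Group ℚP.+-0-group
  using () renaming (identityˡ-unique to +-identityˡ-unique; ∙-cancelʳ to +-cancelʳ)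

*-cancelˡ-≢0 : ∀ {a x y} → ¬ (a ≡ 0ℚ) → a * x ≡ a * y → x ≡ y
*-cancelˡ-≢0 {a} {x} {y} a≢0 e = begin
    x                  ≡⟨ sym (ℚP.*-identityˡ x) ⟩
    1ℚ * x             ≡⟨ cong (_* x) (sym (ℚP.*-inverseˡ a)) ⟩
    ((1/ a) * a) * x   ≡⟨ ℚP.*-assoc (1/ a) a x ⟩
    (1/ a) * (a * x)   ≡⟨ cong ((1/ a) *_) e ⟩
    (1/ a) * (a * y)   ≡⟨ sym (ℚP.*-assoc (1/ a) a y) ⟩
    ((1/ a) * a) * y   ≡⟨ cong (_* y) (ℚP.*-inverseˡ a) ⟩
    1ℚ * y             ≡⟨ ℚP.*-identityˡ y ⟩
    y                  ∎
  where
  open ≡-Reasoning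
  instance _ = ≢-nonZero a≢0

zero-product : ∀ {a b} → a * b ≡ 0ℚ → a ≡ 0ℚ ⊎ b ≡ 0ℚ
zero-product {a} {b} ab≡0 with a ℚP.≟ 0ℚ
... | yes a≡0 = inj₁ a≡0
... | no  a≢0 = inj₂ (*-cancelˡ-≢0 a≢0 (trans ab≡0 (sym (ℚP.*-zeroʳ a))))

square-zero : ∀ {a} → a * a ≡ 0ℚ → a ≡ 0ℚ
square-zero aa≡0 = [ id , id ]′ (zero-product aa≡0)

*-≢0 : ∀ {a b} → ¬ (a ≡ 0ℚ) → ¬ (b ≡ 0ℚ) → ¬ (a * b ≡ 0ℚ)
*-≢0 a≢0 b≢0 ab≡0 = [ a≢0 , b≢0 ]′ (zero-product ab≡0)

≢0-*-zero : ∀ {a b} → ¬ (a ≡ 0ℚ) → a * b ≡ 0ℚ → b ≡ 0ℚ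
≢0-*-zero a≢0 ab≡0 = [ ⊥-elim ∘ a≢0 , id ]′ (zero-product ab≡0)

*-≢0-zero : ∀ {a b} → ¬ (b ≡ 0ℚ) → a * b ≡ 0ℚ → a ≡ 0ℚ
*-≢0-zero b≢0 ab≡0 = [ id , ⊥-elim ∘ b≢0 ]′ (zero-product ab≡0)

zero-*ˡ : ∀ {a} b → a ≡ 0ℚ → a * b ≡ 0ℚ
zero-*ˡ b refl = ℚP.*-zeroˡ b

zero-*ʳ : ∀ a {b} → b ≡ 0ℚ → a * b ≡ 0ℚ
zero-*ʳ a refl = ℚP.*-zeroʳ a

nonNeg-+ : ∀ {a b} → 0ℚ ≤ℚ a → 0ℚ ≤ℚ b → 0ℚ ≤ℚ a +ℚ b
nonNeg-+ {a} {b} 0≤a 0≤b = subst (_≤ℚ a +ℚ b) (ℚP.+-identityʳ 0ℚ) (ℚP.+-mono-≤ 0≤a 0≤b)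

nonNeg-* : ∀ {a b} → 0ℚ ≤ℚ a → 0ℚ ≤ℚ b → 0ℚ ≤ℚ a * b
nonNeg-* {a} {b} 0≤a 0≤b =
  ℚP.nonNegative⁻¹ (a * b) {{ℚP.nonNeg*nonNeg⇒nonNeg a {{nonNegative 0≤a}} b {{nonNegative 0≤b}}}}

square-nonNeg : ∀ a → 0ℚ ≤ℚ a * a
square-nonNeg a with ℚP.≤-total 0ℚ a
... | inj₁ 0≤a = nonNeg-* 0≤a 0≤a
... | inj₂ a≤0 =
  ℚP.nonNegative⁻¹ (a * a) {{ℚP.nonPos*nonPos⇒nonPos a {{nonPositive a≤0}} a {{nonPositive a≤0}}}}

nonNeg-+-zeroˡ : ∀ {a b} → 0ℚ ≤ℚ a → 0ℚ ≤ℚ b → a +ℚ b ≡ 0ℚ → a ≡ 0ℚ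
nonNeg-+-zeroˡ {a} {b} 0≤a 0≤b a+b≡0 =
  ℚP.≤-antisym (subst (a ≤ℚ_) a+b≡0 a≤a+b) 0≤a
  where
  a≤a+b : a ≤ℚ a +ℚ b
  a≤a+b = subst (_≤ℚ a +ℚ b) (ℚP.+-identityʳ a) (ℚP.+-monoʳ-≤ a 0≤b)

nonNeg-+-zeroʳ : ∀ {a b} → 0ℚ ≤ℚ a → 0ℚ ≤ℚ b → a +ℚ b ≡ 0ℚ → b ≡ 0ℚ
nonNeg-+-zeroʳ {a} {b} 0≤a 0≤b a+b≡0 = nonNeg-+-zeroˡ 0≤b 0≤a (trans (ℚP.+-comm b a) a+b≡0)

variable
  A B : Set

∑ : (A → ℚ) → List A → ℚ
∑ f xs = sumℚ (List.map f xs)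

∑-cong : ∀ {f g : A → ℚ} → (∀ x → f x ≡ g x) → ∀ xs → ∑ f xs ≡ ∑ g xs
∑-cong f≗g []       = refl
∑-cong f≗g (x ∷ xs) = cong₂ _+ℚ_ (f≗g x) (∑-cong f≗g xs)

∑-++ : ∀ (f : A → ℚ) xs ys → ∑ f (xs List.++ ys) ≡ ∑ f xs +ℚ ∑ f ys
∑-++ f []       ys = sym (ℚP.+-identityˡ _)
∑-++ f (x ∷ xs) ys = trans (cong (f x +ℚ_) (∑-++ f xs ys)) (sym (ℚP.+-assoc (f x) _ _))

∑-map : ∀ (f : B → ℚ) (h : A → B) xs → ∑ f (List.map h xs) ≡ ∑ (f ∘ h) xs
∑-map f h []       = refl
∑-map f h (x ∷ xs) = cong (f (h x) +ℚ_) (∑-map f h xs)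

∑-concatMap : ∀ (f : B → ℚ) (g : A → List B) xs →
              ∑ f (concatMap g xs) ≡ ∑ (λ x → ∑ f (g x)) xs
∑-concatMap f g []       = refl
∑-concatMap f g (x ∷ xs) =
  trans (∑-++ f (g x) (concatMap g xs)) (cong (∑ f (g x) +ℚ_) (∑-concatMap f g xs))

∑-+ : ∀ (f g : A → ℚ) xs → ∑ (λ x → f x +ℚ g x) xs ≡ ∑ f xs +ℚ ∑ g xs
∑-+ f g []       = sym (ℚP.+-identityˡ 0ℚ)
∑-+ f g (x ∷ xs) =
  trans (cong (f x +ℚ g x +ℚ_) (∑-+ f g xs)) (+-interchange (f x) (g x) (∑ f xs) (∑ g xs))

∑-*ˡ : ∀ c (f : A → ℚ) xs → ∑ (λ x → c * f x) xs ≡ c * ∑ f xs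
∑-*ˡ c f []       = sym (ℚP.*-zeroʳ c)
∑-*ˡ c f (x ∷ xs) = trans (cong (c * f x +ℚ_) (∑-*ˡ c f xs)) (sym (ℚP.*-distribˡ-+ c (f x) (∑ f xs)))

∑-*ʳ : ∀ c (f : A → ℚ) xs → ∑ (λ x → f x * c) xs ≡ ∑ f xs * c
∑-*ʳ c f xs = trans (∑-cong (λ x → ℚP.*-comm (f x) c) xs) (trans (∑-*ˡ c f xs) (ℚP.*-comm c _))

∑-zero : ∀ {f : A → ℚ} → (∀ x → f x ≡ 0ℚ) → ∀ xs → ∑ f xs ≡ 0ℚ
∑-zero f≡0 []       = refl
∑-zero f≡0 (x ∷ xs) = trans (cong₂ _+ℚ_ (f≡0 x) (∑-zero f≡0 xs)) (ℚP.+-identityʳ 0ℚ)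

∑-nonNeg : ∀ {f : A → ℚ} → (∀ x → 0ℚ ≤ℚ f x) → ∀ xs → 0ℚ ≤ℚ ∑ f xs
∑-nonNeg f≥0 []       = ℚP.≤-refl
∑-nonNeg f≥0 (x ∷ xs) = nonNeg-+ (f≥0 x) (∑-nonNeg f≥0 xs)

∑-nonNeg-zero : ∀ {f : A → ℚ} → (∀ x → 0ℚ ≤ℚ f x) → ∀ xs → ∑ f xs ≡ 0ℚ →
                ∀ {x} → x ∈ xs → f x ≡ 0ℚ
∑-nonNeg-zero f≥0 (y ∷ xs) ∑≡0 (here refl) = nonNeg-+-zeroˡ (f≥0 y) (∑-nonNeg f≥0 xs) ∑≡0
∑-nonNeg-zero f≥0 (y ∷ xs) ∑≡0 (there x∈xs) =
  ∑-nonNeg-zero f≥0 xs (nonNeg-+-zeroʳ (f≥0 y) (∑-nonNeg f≥0 xs) ∑≡0) x∈xs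

∑∑-* : ∀ (a : A → ℚ) (b : B → ℚ) xs ys →
       ∑ (λ x → ∑ (λ y → a x * b y) ys) xs ≡ ∑ a xs * ∑ b ys
∑∑-* a b xs ys = trans (∑-cong (λ x → ∑-*ˡ (a x) b ys) xs) (∑-*ʳ (∑ b ys) a xs)

module _ {d : ℕ} where

  ∑-allVecs-++ : ∀ j k (f : Vec (Fin d) (j + k) → ℚ) →
    ∑ f (allVecs d (j + k)) ≡ ∑ (λ y → ∑ (λ w → f (y ++ w)) (allVecs d k)) (allVecs d j)
  ∑-allVecs-++ zero    k f = sym (ℚP.+-identityʳ _)
  ∑-allVecs-++ (suc j) k f = begin
      ∑ f (concatMap (λ x → List.map (x ∷_) (allVecs d (j + k))) (allFin d))
    ≡⟨ ∑-concatMap f _ (allFin d) ⟩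
      ∑ (λ x → ∑ f (List.map (x ∷_) (allVecs d (j + k)))) (allFin d)
    ≡⟨ ∑-cong (λ x → trans (∑-map f (x ∷_) (allVecs d (j + k))) (∑-allVecs-++ j k (f ∘ (x ∷_))))
              (allFin d) ⟩
      ∑ (λ x → ∑ (λ y → g (x ∷ y)) (allVecs d j)) (allFin d)
    ≡⟨ sym (∑-cong (λ x → ∑-map g (x ∷_) (allVecs d j)) (allFin d)) ⟩
      ∑ (λ x → ∑ g (List.map (x ∷_) (allVecs d j))) (allFin d)
    ≡⟨ sym (∑-concatMap g _ (allFin d)) ⟩
      ∑ g (allVecs d (suc j)) ∎
    where
    open ≡-Reasoning
    g : Vec (Fin d) (suc j) → ℚ
    g y = ∑ (λ w → f (y ++ w)) (allVecs d k)

  ∑-allVecs-1 : ∀ (f : Vec (Fin d) 1 → ℚ) → ∑ f (allVecs d 1) ≡ ∑ (λ x → f (x ∷ [])) (allFin d)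
  ∑-allVecs-1 f = trans (∑-concatMap f (λ x → List.map (x ∷_) (allVecs d 0)) (allFin d))
                        (∑-cong (λ x → ℚP.+-identityʳ _) (allFin d))

  ∈-allVecs : ∀ {m} (v : Vec (Fin d) m) → v ∈ allVecs d m
  ∈-allVecs []      = here refl
  ∈-allVecs (x ∷ v) =
    ∈-concatMap⁺ (λ y → List.map (y ∷_) (allVecs d _))
                 (Any.map (λ { refl → ∈-map⁺ (x ∷_) (∈-allVecs v) }) (∈-allFin x))

∑-EQ : ∀ {n} (x : Fin n) (g : Fin n → ℚ) → ∑ (λ y → EQ x y * g y) (allFin n) ≡ g x
∑-EQ {suc n} x g =
  trans (cong (EQ x zero * g zero +ℚ_)
               (trans (cong (∑ δg) (sym (map-tabulate id Fin.suc))) (∑-map δg Fin.suc (allFin n))))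
        (split-first x)
  where
  δg : Fin (suc n) → ℚ
  δg y = EQ x y * g y
  rest : Fin (suc n) → ℚ
  rest z = ∑ (λ y → EQ z (suc y) * g (suc y)) (allFin n)
  split-first : ∀ z → EQ z zero * g zero +ℚ rest z ≡ g z
  split-first zero    =
    trans (cong₂ _+ℚ_ (ℚP.*-identityˡ (g zero)) (∑-zero (λ y → ℚP.*-zeroˡ (g (suc y))) (allFin n)))
          (ℚP.+-identityʳ (g zero))
  split-first (suc z) =
    trans (cong (_+ℚ rest (suc z)) (ℚP.*-zeroˡ (g zero))) (trans (ℚP.+-identityˡ _) (∑-EQ z (g ∘ suc)))

EQ-nonNeg : ∀ {n} (x y : Fin n) → 0ℚ ≤ℚ EQ x y
EQ-nonNeg x y with x Fin.≟ y
... | yes _ = ℚP.nonNegative⁻¹ 1ℚ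
... | no  _ = ℚP.≤-refl

-- reindex v ρ is the vector whose i-th entry is the (ρ i)-th entry of v; it is how a
-- substitution ρ of variables acts on assignments.
reindex : ∀ {n p} → Vec A p → (Fin n → Fin p) → Vec A n
reindex v ρ = tabulate (lookup v ∘ ρ)

lookup-reindex : ∀ {n p} (v : Vec A p) (ρ : Fin n → Fin p) i → lookup (reindex v ρ) i ≡ lookup v (ρ i)
lookup-reindex v ρ = lookup∘tabulate (lookup v ∘ ρ)

vec-ext : ∀ {n} {u v : Vec A n} → (∀ i → lookup u i ≡ lookup v i) → u ≡ v
vec-ext {u = u} {v} u≗v = trans (sym (tabulate∘lookup u)) (trans (tabulate-cong u≗v) (tabulate∘lookup v))

reindex-id : ∀ {n} (v : Vec A n) → reindex v id ≡ v
reindex-id = tabulate∘lookup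

reindex-∘ : ∀ {n p q} (v : Vec A q) (ρ : Fin p → Fin q) (σ : Fin n → Fin p) →
            reindex v (ρ ∘ σ) ≡ reindex (reindex v ρ) σ
reindex-∘ v ρ σ = vec-ext λ i →
  trans (lookup-reindex v (ρ ∘ σ) i) (sym (trans (lookup-reindex (reindex v ρ) σ i) (lookup-reindex v ρ (σ i))))

reindex-↑ˡ : ∀ {j k} (y : Vec A j) (w : Vec A k) → reindex (y ++ w) (_↑ˡ k) ≡ y
reindex-↑ˡ {k = k} y w = vec-ext λ i → trans (lookup-reindex (y ++ w) (_↑ˡ k) i) (lookup-++ˡ y w i)

reindex-↑ʳ : ∀ {j k} (y : Vec A j) (w : Vec A k) → reindex (y ++ w) (j ↑ʳ_) ≡ w
reindex-↑ʳ {j = j} y w = vec-ext λ i → trans (lookup-reindex (y ++ w) (j ↑ʳ_) i) (lookup-++ʳ y w i)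

_⊕_ : ∀ {n k p} → (Fin n → Fin p) → (Fin k → Fin p) → Fin (n + k) → Fin p
_⊕_ {n} ρ σ i = [ ρ , σ ]′ (splitAt n i)

reindex-⊕ : ∀ {n k p} (v : Vec A p) (ρ : Fin n → Fin p) (σ : Fin k → Fin p) →
            reindex v (ρ ⊕ σ) ≡ reindex v ρ ++ reindex v σ
reindex-⊕ {n = n} v ρ σ = vec-ext λ i →
  trans (lookup-reindex v (ρ ⊕ σ) i)
        (trans (on-part (splitAt n i)) (sym (lookup-splitAt n (reindex v ρ) (reindex v σ) i)))
  where
  on-part : ∀ s → lookup v ([ ρ , σ ]′ s) ≡ [ lookup (reindex v ρ) , lookup (reindex v σ) ]′ s
  on-part (inj₁ a) = sym (lookup-reindex v ρ a)
  on-part (inj₂ b) = sym (lookup-reindex v σ b)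

_⊞_ : ∀ {n k p q} → (Fin n → Fin p) → (Fin k → Fin q) → Fin (n + k) → Fin (p + q)
_⊞_ {p = p} {q = q} ρ σ = ((_↑ˡ q) ∘ ρ) ⊕ ((p ↑ʳ_) ∘ σ)

reindex-⊞ : ∀ {n k p q} (v : Vec A p) (w : Vec A q) (ρ : Fin n → Fin p) (σ : Fin k → Fin q) →
            reindex (v ++ w) (ρ ⊞ σ) ≡ reindex v ρ ++ reindex w σ
reindex-⊞ {p = p} {q} v w ρ σ = begin
    reindex (v ++ w) (((_↑ˡ q) ∘ ρ) ⊕ ((p ↑ʳ_) ∘ σ))
  ≡⟨ reindex-⊕ (v ++ w) ((_↑ˡ q) ∘ ρ) ((p ↑ʳ_) ∘ σ) ⟩
    reindex (v ++ w) ((_↑ˡ q) ∘ ρ) ++ reindex (v ++ w) ((p ↑ʳ_) ∘ σ)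
  ≡⟨ cong₂ _++_ (reindex-∘ (v ++ w) (_↑ˡ q) ρ) (reindex-∘ (v ++ w) (p ↑ʳ_) σ) ⟩
    reindex (reindex (v ++ w) (_↑ˡ q)) ρ ++ reindex (reindex (v ++ w) (p ↑ʳ_)) σ
  ≡⟨ cong₂ _++_ (cong (λ u → reindex u ρ) (reindex-↑ˡ v w))
                (cong (λ u → reindex u σ) (reindex-↑ʳ v w)) ⟩
    reindex v ρ ++ reindex w σ ∎
  where open ≡-Reasoning

reassoc : ∀ p j k → Fin ((p + j) + k) → Fin (p + (j + k))
reassoc p j k = (_⊞_ {p} {j} id (_↑ˡ k)) ⊕ ((p ↑ʳ_) ∘ (j ↑ʳ_))

reindex-reassoc : ∀ {p j k} (v : Vec A p) (y : Vec A j) (w : Vec A k) →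
                  reindex (v ++ (y ++ w)) (reassoc p j k) ≡ (v ++ y) ++ w
reindex-reassoc {p = p} {j} {k} v y w = begin
    reindex (v ++ (y ++ w)) (reassoc p j k)
  ≡⟨ reindex-⊕ (v ++ (y ++ w)) (_⊞_ {p} {j} id (_↑ˡ k)) ((p ↑ʳ_) ∘ (j ↑ʳ_)) ⟩
    reindex (v ++ (y ++ w)) (_⊞_ {p} {j} id (_↑ˡ k)) ++ reindex (v ++ (y ++ w)) ((p ↑ʳ_) ∘ (j ↑ʳ_))
  ≡⟨ cong₂ _++_ (reindex-⊞ v (y ++ w) id (_↑ˡ k)) (reindex-∘ (v ++ (y ++ w)) (p ↑ʳ_) (j ↑ʳ_)) ⟩
    (reindex v id ++ reindex (y ++ w) (_↑ˡ k)) ++ reindex (reindex (v ++ (y ++ w)) (p ↑ʳ_)) (j ↑ʳ_)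
  ≡⟨ cong₂ _++_ (cong₂ _++_ (reindex-id v) (reindex-↑ˡ y w))
                (trans (cong (λ u → reindex u (j ↑ʳ_)) (reindex-↑ʳ v (y ++ w))) (reindex-↑ʳ y w)) ⟩
    (v ++ y) ++ w ∎
  where open ≡-Reasoning

module Clone {d : ℕ} (L : Lang d) where

  weight : ∀ {m} → List (Atom L m) → Vec (Fin d) m → ℚ
  weight atoms env = foldr (λ a acc → evalAtom a env * acc) 1ℚ atoms

  weight-++ : ∀ {m} (as bs : List (Atom L m)) env → weight (as List.++ bs) env ≡ weight as env * weight bs env
  weight-++ []       bs env = sym (ℚP.*-identityˡ _)
  weight-++ (a ∷ as) bs env =
    trans (cong (evalAtom a env *_) (weight-++ as bs env)) (sym (ℚP.*-assoc (evalAtom a env) _ _))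

  rename : ∀ {m m'} → (Fin m → Fin m') → List (Atom L m) → List (Atom L m')
  rename ρ = List.map renameAtom
    where
    renameAtom : Atom L _ → Atom L _
    renameAtom (lang G G∈L vs) = lang G G∈L (Vec.map ρ vs)
    renameAtom (eq i j)        = eq (ρ i) (ρ j)

  weight-rename : ∀ {m m'} (ρ : Fin m → Fin m') as env → weight (rename ρ as) env ≡ weight as (reindex env ρ)
  weight-rename ρ []                     env = refl
  weight-rename ρ (lang G G∈L vs ∷ as) env = cong₂ _*_
    (cong G (trans (sym (map-∘ (lookup env) ρ vs)) (map-cong (λ i → sym (lookup-reindex env ρ i)) vs)))
    (weight-rename ρ as env)
  weight-rename ρ (eq i j ∷ as)          env = cong₂ _*_
    (cong₂ EQ (sym (lookup-reindex env ρ i)) (sym (lookup-reindex env ρ j)))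
    (weight-rename ρ as env)

  weight-rename-⊞ : ∀ {n k p q} (ρ : Fin n → Fin p) (σ : Fin k → Fin q) as v u →
                    weight (rename (ρ ⊞ σ) as) (v ++ u) ≡ weight as (reindex v ρ ++ reindex u σ)
  weight-rename-⊞ ρ σ as v u = trans (weight-rename (ρ ⊞ σ) as (v ++ u)) (cong (weight as) (reindex-⊞ v u ρ σ))

  clone-ext : ∀ {n} {F G : Fun d n} → InClone L n F → (∀ v → G v ≡ F v) → InClone L n G
  clone-ext (φ , F≡φ) G≡F = φ , λ v → trans (G≡F v) (F≡φ v)

  clone-rename : ∀ {n p} {F : Fun d n} → InClone L n F → (ρ : Fin n → Fin p) →
                 InClone L p (λ v → F (reindex v ρ))
  clone-rename (pps k as , F≡) ρ = pps k (rename (ρ ⊞ id) as) , λ v →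
    trans (F≡ (reindex v ρ))
          (∑-cong (λ y → sym (trans (weight-rename-⊞ ρ id as v y)
                                    (cong (λ u → weight as (reindex v ρ ++ u)) (reindex-id y))))
                  (allVecs d k))

  -- Pointwise products: conjoin the atoms, with disjoint bound variables.
  clone-* : ∀ {p} {F G : Fun d p} → InClone L p F → InClone L p G → InClone L p (λ v → F v * G v)
  clone-* {p} {F} {G} (pps k₁ as₁ , F≡) (pps k₂ as₂ , G≡) = pps (k₁ + k₂) atoms , λ v → begin
      F v * G v
    ≡⟨ cong₂ _*_ (F≡ v) (G≡ v) ⟩
      ∑ (λ y → weight as₁ (v ++ y)) (allVecs d k₁) * ∑ (λ w → weight as₂ (v ++ w)) (allVecs d k₂)
    ≡⟨ sym (∑∑-* _ _ (allVecs d k₁) (allVecs d k₂)) ⟩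
      ∑ (λ y → ∑ (λ w → weight as₁ (v ++ y) * weight as₂ (v ++ w)) (allVecs d k₂)) (allVecs d k₁)
    ≡⟨ sym (∑-cong (λ y → ∑-cong (weight-atoms v y) (allVecs d k₂)) (allVecs d k₁)) ⟩
      ∑ (λ y → ∑ (λ w → weight atoms (v ++ (y ++ w))) (allVecs d k₂)) (allVecs d k₁)
    ≡⟨ sym (∑-allVecs-++ k₁ k₂ (λ u → weight atoms (v ++ u))) ⟩
      ⟦ pps (k₁ + k₂) atoms ⟧ v ∎
    where
    open ≡-Reasoning
    atoms₁ atoms₂ atoms : List (Atom L (p + (k₁ + k₂)))
    atoms₁ = rename (_⊞_ {p} id (_↑ˡ k₂)) as₁
    atoms₂ = rename (_⊞_ {p} id (k₁ ↑ʳ_)) as₂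
    atoms  = atoms₁ List.++ atoms₂
    weight-atoms : ∀ v y w → weight atoms (v ++ (y ++ w)) ≡ weight as₁ (v ++ y) * weight as₂ (v ++ w)
    weight-atoms v y w = trans (weight-++ atoms₁ atoms₂ (v ++ (y ++ w))) (cong₂ _*_
      (trans (weight-rename-⊞ id (_↑ˡ k₂) as₁ v (y ++ w))
             (cong (weight as₁) (cong₂ _++_ (reindex-id v) (reindex-↑ˡ y w))))
      (trans (weight-rename-⊞ id (k₁ ↑ʳ_) as₂ v (y ++ w))
             (cong (weight as₂) (cong₂ _++_ (reindex-id v) (reindex-↑ʳ y w)))))

  -- Summing out the last j variables: they join the bound variables.
  clone-∑ : ∀ {p j} {F : Fun d (p + j)} → InClone L (p + j) F →
            InClone L p (λ v → ∑ (λ y → F (v ++ y)) (allVecs d j))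
  clone-∑ {p} {j} (pps k as , F≡) = pps (j + k) (rename (reassoc p j k) as) , λ v →
    trans (∑-cong (λ y → F≡ (v ++ y)) (allVecs d j))
          (sym (trans (∑-allVecs-++ j k _)
                      (∑-cong (λ y → ∑-cong (λ w → trans (weight-rename (reassoc p j k) as _)
                                                          (cong (weight as) (reindex-reassoc v y w)))
                                             (allVecs d k))
                              (allVecs d j))))

  clone-unary : Conservative L → (u : Fin d → ℚ) → (∀ x → 0ℚ ≤ℚ u x) →
                InClone L 1 (λ v → u (lookup v zero))
  clone-unary conservative u u≥0 with conservative u u≥0
  ... | G , G∈L , G≡u = pps 0 (lang G G∈L (zero ∷ []) ∷ []) , λ { (x ∷ []) →
        sym (trans (ℚP.+-identityʳ _) (trans (ℚP.*-identityʳ _) (G≡u x))) }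

  clone-nonNeg : NonNeg L → ∀ {n} {F : Fun d n} → InClone L n F → ∀ x → 0ℚ ≤ℚ F x
  clone-nonNeg L≥0 (pps k as , F≡) x =
    subst (0ℚ ≤ℚ_) (sym (F≡ x)) (∑-nonNeg (λ y → weight-nonNeg as (x ++ y)) (allVecs d k))
    where
    atom-nonNeg : ∀ {m} (a : Atom L m) env → 0ℚ ≤ℚ evalAtom a env
    atom-nonNeg (lang G G∈L vs) env = L≥0 _ G G∈L _
    atom-nonNeg (eq i j)        env = EQ-nonNeg (lookup env i) (lookup env j)
    weight-nonNeg : ∀ {m} (as : List (Atom L m)) env → 0ℚ ≤ℚ weight as env
    weight-nonNeg []       env = ℚP.nonNegative⁻¹ 1ℚ
    weight-nonNeg (a ∷ as) env = nonNeg-* (atom-nonNeg a env) (weight-nonNeg as env)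

-- Equality case of the Cauchy–Schwarz inequality on a finite list xs:
-- (Σ a²)(Σ b²) = (Σ ab)² forces a i b j = a j b i for all i, j in xs.  The reason is
-- Lagrange's identity Σ_i Σ_j (a i b j − a j b i)² = 2 ((Σ a²)(Σ b²) − (Σ ab)²).
module CauchySchwarz {A : Set} (a b : A → ℚ) (xs : List A) where

  minor minor² : A → A → ℚ
  minor i j  = a i * b j - a j * b i
  minor² i j = minor i j * minor i j

  ∑∑ : (A → A → ℚ) → ℚ
  ∑∑ f = ∑ (λ i → ∑ (λ j → f i j) xs) xs

  ∑∑-+ : ∀ f g → ∑∑ (λ i j → f i j +ℚ g i j) ≡ ∑∑ f +ℚ ∑∑ g
  ∑∑-+ f g = trans (∑-cong (λ i → ∑-+ (f i) (g i) xs) xs) (∑-+ _ _ xs)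

  ∑a² ∑b² ∑ab : ℚ
  ∑a² = ∑ (λ i → a i * a i) xs
  ∑b² = ∑ (λ i → b i * b i) xs
  ∑ab = ∑ (λ i → a i * b i) xs

  -- Lagrange's identity, with the factor 2 written as a doubling.
  lagrange : ∑∑ minor² +ℚ (∑ab * ∑ab +ℚ ∑ab * ∑ab) ≡ ∑a² * ∑b² +ℚ ∑a² * ∑b²
  lagrange = begin
      ∑∑ minor² +ℚ (∑ab * ∑ab +ℚ ∑ab * ∑ab)
    ≡⟨ cong (∑∑ minor² +ℚ_)
            (sym (trans (∑∑-+ ab⊗ab ab⊗ab) (cong₂ _+ℚ_ (∑∑-* ab ab xs xs) (∑∑-* ab ab xs xs)))) ⟩
      ∑∑ minor² +ℚ ∑∑ (λ i j → ab⊗ab i j +ℚ ab⊗ab i j)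
    ≡⟨ sym (∑∑-+ minor² _) ⟩
      ∑∑ (λ i j → minor² i j +ℚ (ab⊗ab i j +ℚ ab⊗ab i j))
    ≡⟨ ∑-cong (λ i → ∑-cong (pointwise i) xs) xs ⟩
      ∑∑ (λ i j → (a i * a i) * (b j * b j) +ℚ (a j * a j) * (b i * b i))
    ≡⟨ ∑∑-+ _ _ ⟩
      ∑∑ (λ i j → (a i * a i) * (b j * b j)) +ℚ ∑∑ (λ i j → (a j * a j) * (b i * b i))
    ≡⟨ cong₂ _+ℚ_ (∑∑-* (λ i → a i * a i) (λ j → b j * b j) xs xs)
                  (trans (∑-cong (λ i → ∑-*ʳ (b i * b i) (λ j → a j * a j) xs) xs)
                         (∑-*ˡ ∑a² (λ i → b i * b i) xs)) ⟩
      ∑a² * ∑b² +ℚ ∑a² * ∑b² ∎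
    where
    open ≡-Reasoning
    open +-*-Solver
    ab : A → ℚ
    ab i = a i * b i
    ab⊗ab : A → A → ℚ
    ab⊗ab i j = ab i * ab j
    pointwise : ∀ i j → minor² i j +ℚ (ab⊗ab i j +ℚ ab⊗ab i j)
                        ≡ (a i * a i) * (b j * b j) +ℚ (a j * a j) * (b i * b i)
    pointwise i j = solve 4 (λ x y z w → (x :* y :- z :* w) :* (x :* y :- z :* w)
                                         :+ (x :* w :* (z :* y) :+ x :* w :* (z :* y))
                                       := (x :* x) :* (y :* y) :+ (z :* z) :* (w :* w))
                            refl (a i) (b j) (a j) (b i)

  equality-case : ∑a² * ∑b² ≡ ∑ab * ∑ab → ∀ {i j} → i ∈ xs → j ∈ xs → a i * b j ≡ a j * b i
  equality-case equal {i} {j} i∈xs j∈xs =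
    +-cancelʳ (- (a j * b i)) _ _ (trans (square-zero minor²≡0) (sym (ℚP.+-inverseʳ (a j * b i))))
    where
    ∑∑minor²≡0 : ∑∑ minor² ≡ 0ℚ
    ∑∑minor²≡0 = +-identityˡ-unique _ _ (trans lagrange (cong₂ _+ℚ_ equal equal))
    minor²≥0 : ∀ i j → 0ℚ ≤ℚ minor² i j
    minor²≥0 i j = square-nonNeg (minor i j)
    minor²≡0 : minor² i j ≡ 0ℚ
    minor²≡0 = ∑-nonNeg-zero (minor²≥0 i) xs
                (∑-nonNeg-zero (λ i → ∑-nonNeg (minor²≥0 i) xs) xs ∑∑minor²≡0 i∈xs) j∈xs

Proportional : (A → ℚ) → (A → ℚ) → Set
Proportional a b = ∀ z z' → a z * b z' ≡ a z' * b z

Disjoint : (A → ℚ) → (A → ℚ) → Set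
Disjoint a b = ∀ z → a z * b z ≡ 0ℚ

PropOrDisj : (A → ℚ) → (A → ℚ) → Set
PropOrDisj a b = Proportional a b ⊎ Disjoint a b

PropOrDisj-cong : ∀ {a a' b b' : A → ℚ} → (∀ z → a z ≡ a' z) → (∀ z → b z ≡ b' z) →
                  PropOrDisj a b → PropOrDisj a' b'
PropOrDisj-cong a≗a' b≗b' (inj₁ a∝b) =
  inj₁ λ z z' → trans (sym (cong₂ _*_ (a≗a' z) (b≗b' z')))
                      (trans (a∝b z z') (cong₂ _*_ (a≗a' z') (b≗b' z)))
PropOrDisj-cong a≗a' b≗b' (inj₂ ab≡0) =
  inj₂ λ z → trans (sym (cong₂ _*_ (a≗a' z) (b≗b' z))) (ab≡0 z)

Cross : (a e p q : A → ℚ) → Set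
Cross a e p q = ∀ z z' → a z * e z' ≡ p z' * q z

module _ (a e p q : A → ℚ) (cross : Cross a e p q) where

  transfer-disjoint : Disjoint a p → Disjoint a e
  transfer-disjoint ap≡0 z = [ zero-*ˡ (e z) , id ]′ (zero-product {a z} a·ae≡0)
    where
    a·ae≡0 : a z * (a z * e z) ≡ 0ℚ
    a·ae≡0 = begin
      a z * (a z * e z)   ≡⟨ cong (a z *_) (cross z z) ⟩
      a z * (p z * q z)   ≡⟨ sym (ℚP.*-assoc (a z) (p z) (q z)) ⟩
      (a z * p z) * q z   ≡⟨ zero-*ˡ (q z) (ap≡0 z) ⟩
      0ℚ                  ∎
      where open ≡-Reasoning

  scaled-proportional : Proportional a p → ∀ z z' → a z * (a z * e z') ≡ a z * (a z' * e z)
  scaled-proportional a∝p z z' = begin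
    a z * (a z * e z')    ≡⟨ cong (a z *_) (cross z z') ⟩
    a z * (p z' * q z)    ≡⟨ sym (ℚP.*-assoc (a z) (p z') (q z)) ⟩
    (a z * p z') * q z    ≡⟨ cong (_* q z) (a∝p z z') ⟩
    (a z' * p z) * q z    ≡⟨ ℚP.*-assoc (a z') (p z) (q z) ⟩
    a z' * (p z * q z)    ≡⟨ cong (a z' *_) (sym (cross z z)) ⟩
    a z' * (a z * e z)    ≡⟨ *-left-swap (a z') (a z) (e z) ⟩
    a z * (a z' * e z)    ∎
    where open ≡-Reasoning

  transfer-proportional : Proportional a p → Proportional a e
  transfer-proportional a∝p z z' with a z ℚP.≟ 0ℚ | a z' ℚP.≟ 0ℚ
  ... | no az≢0  | _         = *-cancelˡ-≢0 az≢0 (scaled-proportional a∝p z z')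
  ... | yes _    | no az'≢0  = sym (*-cancelˡ-≢0 az'≢0 (scaled-proportional a∝p z' z))
  ... | yes az≡0 | yes az'≡0 = trans (zero-*ˡ (e z') az≡0) (sym (zero-*ˡ (e z) az'≡0))

  transfer : PropOrDisj a p → PropOrDisj a e
  transfer (inj₁ a∝p)   = inj₁ (transfer-proportional a∝p)
  transfer (inj₂ ap≡0) = inj₂ (transfer-disjoint ap≡0)

-- If a and e are each disjoint from both b and c, then a relation between the sums
-- a + b and c + e restricts to a and e: at every point, either a and e vanish or
-- b and c do.
module _ (a b c e : A → ℚ) (ab : Disjoint a b) (ce : Disjoint c e) (ac : Disjoint a c) (be : Disjoint b e) where

  support-split : ∀ z → (a z ≡ 0ℚ × e z ≡ 0ℚ) ⊎ (b z ≡ 0ℚ × c z ≡ 0ℚ)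
  support-split z with a z ℚP.≟ 0ℚ | e z ℚP.≟ 0ℚ
  ... | no az≢0  | _         = inj₂ (≢0-*-zero az≢0 (ab z) , ≢0-*-zero az≢0 (ac z))
  ... | yes _    | no ez≢0   = inj₂ (*-≢0-zero ez≢0 (be z) , *-≢0-zero ez≢0 (ce z))
  ... | yes az≡0 | yes ez≡0  = inj₁ (az≡0 , ez≡0)

  sum-product : ∀ {z z'} → b z ≡ 0ℚ → c z' ≡ 0ℚ → (a z +ℚ b z) * (c z' +ℚ e z') ≡ a z * e z'
  sum-product {z} {z'} bz≡0 cz'≡0 = cong₂ _*_
    (trans (cong (a z +ℚ_) bz≡0) (ℚP.+-identityʳ (a z)))
    (trans (cong (_+ℚ e z') cz'≡0) (ℚP.+-identityˡ (e z')))

  separated : PropOrDisj (λ z → a z +ℚ b z) (λ z → c z +ℚ e z) → PropOrDisj a e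
  separated (inj₁ sums∝) = inj₁ λ z z' → proportional (support-split z) (support-split z')
    where
    proportional : ∀ {z z'} → _ → _ → a z * e z' ≡ a z' * e z
    proportional {z} {z'} (inj₁ (az≡0 , ez≡0)) _ = trans (zero-*ˡ (e z') az≡0) (sym (zero-*ʳ (a z') ez≡0))
    proportional {z} {z'} _ (inj₁ (az'≡0 , ez'≡0)) = trans (zero-*ʳ (a z) ez'≡0) (sym (zero-*ˡ (e z) az'≡0))
    proportional {z} {z'} (inj₂ (bz≡0 , cz≡0)) (inj₂ (bz'≡0 , cz'≡0)) =
      trans (sym (sum-product bz≡0 cz'≡0)) (trans (sums∝ z z') (sum-product bz'≡0 cz≡0))
  separated (inj₂ sums-disjoint) = inj₂ λ z → disjoint (support-split z)
    where
    disjoint : ∀ {z} → _ → a z * e z ≡ 0ℚ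
    disjoint {z} (inj₁ (az≡0 , _))    = zero-*ˡ (e z) az≡0
    disjoint {z} (inj₂ (bz≡0 , cz≡0)) = trans (sym (sum-product bz≡0 cz≡0)) (sums-disjoint z)

-- The combination step of the row induction, for the four rows a = R(x,s),
-- b = R(x',s), c = R(x,s'), e = R(x',s') of a matrix whose rows are indexed by pairs:
-- relations between the first coordinates x, x', between the tails s, s', and between
-- the row sums a + b and c + e together make a and e proportional or disjoint.
-- (Each hypothesis is stated in the form the argument uses.)
combine : ∀ (a b c e : A → ℚ) →
          Cross a e c b ⊎ (Disjoint a b × Disjoint c e) →
          (Cross a e b c × Proportional a c) ⊎ (Disjoint a c × Disjoint b e) →
          PropOrDisj (λ z → a z +ℚ b z) (λ z → c z +ℚ e z) →
          PropOrDisj a e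
combine a b c e (inj₁ cross)     (inj₁ (_ , a∝c))   _    = transfer a e c b cross (inj₁ a∝c)
combine a b c e (inj₁ cross)     (inj₂ (ac , _))    _    = transfer a e c b cross (inj₂ ac)
combine a b c e (inj₂ (ab , _))  (inj₁ (cross , _)) _    = transfer a e b c cross (inj₂ ab)
combine a b c e (inj₂ (ab , ce)) (inj₂ (ac , be))   sums = separated a b c e ab ce ac be sums

-- A matrix whose rows are pairwise proportional or disjoint has block-rank 1: along
-- any path of G_M starting at row r₀ of a nonzero entry M r₀ c₀, rows stay
-- proportional to M r₀ and columns stay in the support of M r₀.
rows-PD⇒BlockRank1 : ∀ {R C : Set} (M : R → C → ℚ) → (∀ r r' → PropOrDisj (M r) (M r')) →
                     BlockRank1 M
rows-PD⇒BlockRank1 {R} {C} M rows-PD r₀ c₀ a≢0 = u , v , λ r c r₀~r _ → factor r c (along r₀~r r₀∝r₀)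
  where
  a : ℚ
  a = M r₀ c₀
  instance _ = ≢-nonZero a≢0
  u : R → ℚ
  u r = M r c₀ * 1/ a
  v : C → ℚ
  v c = M r₀ c
  Reached : R ⊎ C → Set
  Reached (inj₁ r) = Proportional (M r₀) (M r)
  Reached (inj₂ c) = ¬ (M r₀ c ≡ 0ℚ)
  r₀∝r₀ : Reached (inj₁ r₀)
  r₀∝r₀ z z' = ℚP.*-comm (M r₀ z) (M r₀ z')
  step : ∀ {p q} → Edge M p q → Reached p → Reached q
  step (rc r c Mrc≢0) r₀∝r M₀c≡0 =
    *-≢0 a≢0 Mrc≢0 (trans (r₀∝r c₀ c) (zero-*ˡ (M r c₀) M₀c≡0))
  step (cr r c Mrc≢0) M₀c≢0 with rows-PD r₀ r
  ... | inj₁ r₀∝r      = r₀∝r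
  ... | inj₂ disjoint = ⊥-elim (*-≢0 M₀c≢0 Mrc≢0 (disjoint c))
  along : ∀ {p q} → Star (Edge M) p q → Reached p → Reached q
  along ε         reached = reached
  along (e ◅ es) reached = along es (step e reached)
  factor : ∀ r c → Proportional (M r₀) (M r) → M r c ≡ u r * v c
  factor r c r₀∝r = *-cancelˡ-≢0 a≢0 (begin
      a * M r c                  ≡⟨ r₀∝r c₀ c ⟩
      M r₀ c * M r c₀            ≡⟨ sym (ℚP.*-identityˡ _) ⟩
      1ℚ * (M r₀ c * M r c₀)     ≡⟨ cong (_* (M r₀ c * M r c₀)) (sym (ℚP.*-inverseʳ a)) ⟩
      (a * 1/ a) * (M r₀ c * M r c₀)
        ≡⟨ solve 4 (λ a i y x → (a :* i) :* (y :* x) := a :* ((x :* i) :* y)) refl a (1/ a) (M r₀ c) (M r c₀) ⟩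
      a * (u r * v c)            ∎)
    where
    open ≡-Reasoning
    open +-*-Solver

move-front : ∀ k m → Fin (suc (k + m)) → Fin (k + suc m)
move-front k m zero    = k ↑ʳ zero
move-front k m (suc i) = _⊞_ {k} {m} id suc i

reindex-move-front : ∀ {k m} (s : Vec A k) y (c : Vec A m) →
                     reindex (s ++ (y ∷ c)) (move-front k m) ≡ y ∷ (s ++ c)
reindex-move-front s y c = cong₂ _∷_ (lookup-++ʳ s (y ∷ c) zero)
  (trans (reindex-⊞ s (y ∷ c) id suc) (cong₂ _++_ (reindex-id s) (tabulate∘lookup c)))

move-last : ∀ n → Fin (suc n) → Fin (n + 1)
move-last n zero    = n ↑ʳ zero
move-last n (suc i) = i ↑ˡ 1

reindex-move-last : ∀ {n} (v : Vec A n) y → reindex (v ++ (y ∷ [])) (move-last n) ≡ y ∷ v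
reindex-move-last v y = cong₂ _∷_ (lookup-++ʳ v (y ∷ []) zero) (reindex-↑ˡ v (y ∷ []))

module RowInduction {d : ℕ} (L : Lang d) (L≥0 : NonNeg L) (conservative : Conservative L)
                    (wlm : WeaklyLogModular L) where
  open Clone L

  gram : ∀ {n} → Fun d (suc n) → Fun d 2
  gram {n} F (u ∷ w ∷ []) = ∑ (λ z → F (u ∷ z) * F (w ∷ z)) (allVecs d n)

  gram-in-clone : ∀ {n} {F : Fun d (suc n)} → InClone L (suc n) F → InClone L 2 (gram F)
  gram-in-clone {n} {F} F∈ =
    clone-ext (clone-∑ {p = 2} (clone-* (clone-rename F∈ copy₁) (clone-rename F∈ copy₂)))
      λ { (u ∷ w ∷ []) →
            ∑-cong (λ z → cong (λ t → F (u ∷ t) * F (w ∷ t)) (sym (tabulate∘lookup z))) (allVecs d n) }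
    where
    copy₁ copy₂ : Fin (suc n) → Fin (2 + n)
    copy₁ zero    = zero
    copy₁ (suc i) = suc (suc i)
    copy₂ zero    = suc zero
    copy₂ (suc i) = suc (suc i)

  -- Weak log-modularity of the Gram function is the equality case of Cauchy–Schwarz,
  -- or makes a row, resp. the overlap of the two rows, vanish.
  first-coordinate-PD : ∀ {n} {F : Fun d (suc n)} → InClone L (suc n) F → (x x' : Fin d) →
                        PropOrDisj (λ z → F (x ∷ z)) (λ z → F (x' ∷ z))
  first-coordinate-PD {n} {F} F∈ x x' with wlm (gram F) (gram-in-clone F∈) x x'
  ... | inj₁ log-modular = inj₁ λ z z' → equality-case gram-equality (∈-allVecs z) (∈-allVecs z')
    where
    open CauchySchwarz (λ z → F (x ∷ z)) (λ z → F (x' ∷ z)) (allVecs d n)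
    gram-equality : ∑a² * ∑b² ≡ ∑ab * ∑ab
    gram-equality =
      trans log-modular (cong (∑ab *_) (∑-cong (λ z → ℚP.*-comm (F (x' ∷ z)) (F (x ∷ z))) (allVecs d n)))
  ... | inj₂ (inj₁ (row-norm≡0 , _)) = inj₂ λ z → zero-*ˡ (F (x' ∷ z)) (row-zero z)
    where
    row-zero : ∀ z → F (x ∷ z) ≡ 0ℚ
    row-zero z = square-zero {F (x ∷ z)}
      (∑-nonNeg-zero (λ z → square-nonNeg (F (x ∷ z))) (allVecs d n) row-norm≡0 (∈-allVecs z))
  ... | inj₂ (inj₂ (overlap≡0 , _)) =
    inj₂ λ z → ∑-nonNeg-zero overlap≥0 (allVecs d n) overlap≡0 (∈-allVecs z)
    where
    overlap≥0 : ∀ z → 0ℚ ≤ℚ F (x ∷ z) * F (x' ∷ z)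
    overlap≥0 z = nonNeg-* (clone-nonNeg L≥0 F∈ (x ∷ z)) (clone-nonNeg L≥0 F∈ (x' ∷ z))

  -- Merging two values x, x' of the first coordinate stays in the clone, because
  -- F(x,v) + F(x',v) = Σ_y (EQ x y + EQ x' y) F(y,v) with a unary weight from L.
  merge-in-clone : ∀ {n} {F : Fun d (suc n)} → InClone L (suc n) F → (x x' : Fin d) →
                   InClone L n (λ v → F (x ∷ v) +ℚ F (x' ∷ v))
  merge-in-clone {n} {F} F∈ x x' =
    clone-ext (clone-∑ {p = n} {j = 1} (clone-rename weighted (move-last n))) merged
    where
    δ : Fin d → ℚ
    δ y = EQ x y +ℚ EQ x' y
    G : Fun d (suc n)
    G w = δ (lookup w zero) * F w
    weighted : InClone L (suc n) G
    weighted = clone-* (clone-rename (clone-unary conservative δ δ≥0) (λ _ → zero)) F∈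
      where
      δ≥0 : ∀ y → 0ℚ ≤ℚ δ y
      δ≥0 y = nonNeg-+ (EQ-nonNeg x y) (EQ-nonNeg x' y)
    merged : ∀ v → F (x ∷ v) +ℚ F (x' ∷ v) ≡ ∑ (λ y → G (reindex (v ++ y) (move-last n))) (allVecs d 1)
    merged v = sym (begin
        ∑ (λ y → G (reindex (v ++ y) (move-last n))) (allVecs d 1)
      ≡⟨ ∑-allVecs-1 {d} _ ⟩
        ∑ (λ y → G (reindex (v ++ (y ∷ [])) (move-last n))) (allFin d)
      ≡⟨ ∑-cong (λ y → cong G (reindex-move-last v y)) (allFin d) ⟩
        ∑ (λ y → δ y * F (y ∷ v)) (allFin d)
      ≡⟨ ∑-cong (λ y → ℚP.*-distribʳ-+ (F (y ∷ v)) (EQ x y) (EQ x' y)) (allFin d) ⟩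
        ∑ (λ y → EQ x y * F (y ∷ v) +ℚ EQ x' y * F (y ∷ v)) (allFin d)
      ≡⟨ ∑-+ _ _ (allFin d) ⟩
        ∑ (λ y → EQ x y * F (y ∷ v)) (allFin d) +ℚ ∑ (λ y → EQ x' y * F (y ∷ v)) (allFin d)
      ≡⟨ cong₂ _+ℚ_ (∑-EQ x (λ y → F (y ∷ v))) (∑-EQ x' (λ y → F (y ∷ v))) ⟩
        F (x ∷ v) +ℚ F (x' ∷ v) ∎)
      where open ≡-Reasoning

  rows-PD : ∀ k m {F : Fun d (k + m)} → InClone L (k + m) F → (r r' : Vec (Fin d) k) →
            PropOrDisj (λ c → F (r ++ c)) (λ c → F (r' ++ c))
  rows-PD zero    m {F} F∈ [] [] = inj₁ λ c c' → ℚP.*-comm (F c) (F c')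
  rows-PD (suc k) m {F} F∈ (x ∷ s) (x' ∷ s') = combine a b c e first-coordinates tails merged
    where
    a b c e : Vec (Fin d) m → ℚ
    a col = F (x ∷ s ++ col)
    b col = F (x' ∷ s ++ col)
    c col = F (x ∷ s' ++ col)
    e col = F (x' ∷ s' ++ col)
    first-coordinates : Cross a e c b ⊎ (Disjoint a b × Disjoint c e)
    first-coordinates with first-coordinate-PD F∈ x x'
    ... | inj₁ x∝x'      = inj₁ λ col col' → x∝x' (s ++ col) (s' ++ col')
    ... | inj₂ disjoint = inj₂ ((λ col → disjoint (s ++ col)) , (λ col → disjoint (s' ++ col)))
    tail-slice : Vec (Fin d) k → Vec (Fin d) (suc m) → ℚ
    tail-slice t (y ∷ col) = F (y ∷ (t ++ col))
    tail-slice-moved : ∀ t yc → F (reindex (t ++ yc) (move-front k m)) ≡ tail-slice t yc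
    tail-slice-moved t (y ∷ col) = cong F (reindex-move-front t y col)
    tails : (Cross a e b c × Proportional a c) ⊎ (Disjoint a c × Disjoint b e)
    tails with PropOrDisj-cong (tail-slice-moved s) (tail-slice-moved s')
                               (rows-PD k (suc m) (clone-rename F∈ (move-front k m)) s s')
    ... | inj₁ s∝s'      = inj₁ ((λ col col' → s∝s' (x ∷ col) (x' ∷ col')) ,
                                 (λ col col' → s∝s' (x ∷ col) (x ∷ col')))
    ... | inj₂ disjoint = inj₂ ((λ col → disjoint (x ∷ col)) , (λ col → disjoint (x' ∷ col)))
    merged : PropOrDisj (λ col → a col +ℚ b col) (λ col → c col +ℚ e col)
    merged = rows-PD k m (merge-in-clone F∈ x x') s s'

lemma5 : (d : ℕ) → 2 ≤ d → (L : Lang d) → NonNeg L →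
         Conservative L → WeaklyLogModular L → Balanced L
lemma5 d _ L L≥0 conservative wlm k m _ _ F F∈ =
  rows-PD⇒BlockRank1 (λ r c → F (r ++ c)) (rows-PD k m F∈)
  where open RowInduction L L≥0 conservative wlm
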